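{- Let $F=Ax^2+C\in\mathbb{Q}[x]$ with $A\neq 0$ (i.e. $B=0$). Then $V(F)^{\mathrm{con}}_{1,1}$ is non-empty if and only if there exists $b_1\in\mathcal{O}$ with $|b_1|_p>1$ such that $-C/A=b_1^2+1$. In this case $V(F)^{\mathrm{con}}_{1,1}=\{\pm(b_1,2b_1)\}$.
   Context: Let $p$ be a fixed odd prime, $|\cdot|_p$ the $p$-adic absolute value, $\mathcal{O}=\mathbb{Z}[1/p]$. For a sequence $c_1,c_2,\dots$ put $A_0=1$, $A_1=c_1$, $A_n=c_nA_{n-1}+A_{n-2}$, $B_0=0$, $B_1=1$, $B_n=c_nB_{n-1}+B_{n-2}$; the $n$-th convergent is $[A_n:B_n]\in\mathbb{P}^1(\mathbb{Q})$ and $[c_1,c_2,\dots]$ converges $p$-adically if the convergents converge in $\mathbb{P}^1(\mathbb{Q}_p)$. Let $M(c_1,\dots,c_n)=\prod_{i=1}^n\begin{pmatrix}c_i&1\\1&0\end{pmatrix}$. The periodic continued fraction of type $(1,1)$ is $[b_1,\overline{a_1}]=[b_1,a_1,a_1,\dots]$, identified with $(b_1,a_1)\in\mathbb{A}^2$. Let $E=(E_{ij})=M(b_1)M(a_1)M(b_1)^{ -1}$, so $E_{21}x^2+(E_{22}-E_{11})x-E_{12}=x^2+(a_1-2b_1)x+b_1^2-a_1b_1-1$. For $F=Ax^2+Bx+C$, $V(F)_{1,1}\subseteq\mathbb{A}^2$ is defined by $A(E_{22}-E_{11})=BE_{21}$, $-AE_{12}=CE_{21}$, $-BE_{12}=C(E_{22}-E_{11})$;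 $V(F)^{\mathrm{con}}_{1,1}$ is the set of its points with coordinates in $\mathcal{O}$ whose continued fraction converges $p$-adically. -}

module Defs where

open import Data.Nat as ℕ using (ℕ; zero; suc; _≤_)
open import Data.Nat.Divisibility using (_∣_)
open import Data.Integer as ℤ using (ℤ; +_)
open import Data.Rational using (ℚ; _+_; _*_; -_; _-_; _/_; 0ℚ; 1ℚ)
open import Data.Product using (Σ; ∃; _×_; _,_)
open import Data.Sum using (_⊎_)
open import Relation.Nullary using (¬_)
open import Relation.Binary.PropositionalEquality using (_≡_; _≢_)

ℕtoℚ : ℕ → ℚ
ℕtoℚ n = (+ n) / 1

ℤtoℚ : ℤ → ℚ
ℤtoℚ z = z / 1

-- membership in 𝒪 = ℤ[1/p]:  q · p^k ∈ ℤ for some k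
InO : ℕ → ℚ → Set
InO p q = ∃ λ (k : ℕ) → ∃ λ (a : ℤ) → q * ℕtoℚ (p ℕ.^ k) ≡ ℤtoℚ a

-- |x|_p ≤ p^{-k} · |y|_p   (k : ℕ), i.e. x = p^k (a/d) y with a ∈ ℤ, d ∈ ℕ, d ≠ 0, p ∤ d
AbsLeMul : ℕ → ℕ → ℚ → ℚ → Set
AbsLeMul p k x y =
  ∃ λ (a : ℤ) → ∃ λ (d : ℕ) →
    (d ≢ 0) × (¬ (p ∣ d)) × (x * ℕtoℚ d ≡ ℤtoℚ a * ℕtoℚ (p ℕ.^ k) * y)

-- chordal distance on P^1(Q_p):
--   d([a:b],[c:e]) = |ae - bc|_p / (max(|a|_p,|b|_p) · max(|c|_p,|e|_p)).
-- ChordLe p k (a,b) (c,e)  :⇔  d([a:b],[c:e]) ≤ p^{-k}.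
-- (max(|a|,|b|)·max(|c|,|e|) = max(|ac|,|ae|,|bc|,|be|).)
ChordLe : ℕ → ℕ → ℚ × ℚ → ℚ × ℚ → Set
ChordLe p k (a , b) (c , e) =
  AbsLeMul p k (a * e - b * c) (a * c) ⊎
  AbsLeMul p k (a * e - b * c) (a * e) ⊎
  AbsLeMul p k (a * e - b * c) (b * c) ⊎
  AbsLeMul p k (a * e - b * c) (b * e)

-- convergents of [c 1, c 2, ...]  (c 0 is unused)
mutual
  Aₙ : (ℕ → ℚ) → ℕ → ℚ
  Aₙ c zero = 1ℚ
  Aₙ c (suc zero) = c 1
  Aₙ c (suc (suc n)) = c (suc (suc n)) * Aₙ c (suc n) + Aₙ c n

  Bₙ : (ℕ → ℚ) → ℕ → ℚ
  Bₙ c zero = 0ℚ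
  Bₙ c (suc zero) = 1ℚ
  Bₙ c (suc (suc n)) = c (suc (suc n)) * Bₙ c (suc n) + Bₙ c n

convergent : (ℕ → ℚ) → ℕ → ℚ × ℚ
convergent c n = (Aₙ c n , Bₙ c n)

-- p-adic convergence of the convergents in P^1(Q_p); since P^1(Q_p) is compact
-- (hence complete) w.r.t. the chordal metric, this is the Cauchy condition.
PAdicConverges : ℕ → (ℕ → ℚ) → Set
PAdicConverges p c =
  ∀ (k : ℕ) → ∃ λ (N : ℕ) → ∀ m n → N ≤ m → N ≤ n →
    ChordLe p k (convergent c m) (convergent c n)

-- the sequence of partial quotients of [b₁, a₁, a₁, ...]
type11 : ℚ → ℚ → ℕ → ℚ
type11 b a zero = b        -- unused index
type11 b a (suc zero) = b
type11 b a (suc (suc n)) = a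

Mat : Set
Mat = (ℚ × ℚ) × (ℚ × ℚ)

_⊗_ : Mat → Mat → Mat
((a , b) , (c , d)) ⊗ ((e , f) , (g , h)) =
  ((a * e + b * g , a * f + b * h) , (c * e + d * g , c * f + d * h))

Mc : ℚ → Mat
Mc x = ((x , 1ℚ) , (1ℚ , 0ℚ))

McInv : ℚ → Mat
McInv x = ((0ℚ , 1ℚ) , (1ℚ , - x))

Emat : ℚ → ℚ → Mat
Emat b a = (Mc b ⊗ Mc a) ⊗ McInv b

E11 E12 E21 E22 : Mat → ℚ
E11 ((x , _) , _) = x
E12 ((_ , x) , _) = x
E21 (_ , (x , _)) = x
E22 (_ , (_ , x)) = x

InV : ℚ → ℚ → ℚ → ℚ → ℚ → Set
InV A B C b a =
  let E = Emat b a in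
  (A * (E22 E - E11 E) ≡ B * E21 E) ×
  (- (A * E12 E) ≡ C * E21 E) ×
  (- (B * E12 E) ≡ C * (E22 E - E11 E))

InVcon : ℕ → ℚ → ℚ → ℚ → ℚ → ℚ → Set
InVcon p A B C b a =
  InV A B C b a × InO p b × InO p a × PAdicConverges p (type11 b a)

-- With B = 0 the equations of V(F)₁,₁ say exactly that a₁ = 2b₁ and −C/A = b₁² + 1, so b₁ is
-- determined up to sign, and everything hinges on whether [b₁, 2b₁, 2b₁, …] converges p-adically.
-- If b₁ is p-integral then so are all continuants Aₙ, Bₙ, while Aₙ Bₙ₊₁ − Bₙ Aₙ₊₁ = ±1; hence
-- consecutive convergents stay at chordal distance 1.  If instead b₁ P = z with P = pˢ⁺¹ and z a
-- p-adic unit, then Pⁿ Aₙ and Pⁿ Bₙ are integers obeying Xₙ₊₂ = 2z Xₙ₊₁ + P² Xₙ.  As p is odd,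
-- every Pⁿ Aₙ is a unit, and the cross terms Pᵐ⁺ⁿ (Aₘ Bₙ − Bₘ Aₙ) are divisible by p^min(m,n),
-- which bounds the chordal distance of the m-th and n-th convergents by p^−min(m,n).

module Submission where

open import Defs
open import Data.Nat using (ℕ)
open import Data.Nat.Primality using (Prime)
open import Data.Rational using (ℚ; _+_; _*_; -_; _÷_; 0ℚ; 1ℚ; NonZero)
open import Data.Product using (Σ; ∃; _×_; _,_)
open import Data.Sum using (_⊎_)
open import Relation.Nullary using (¬_)
open import Relation.Binary.PropositionalEquality using (_≡_; _≢_)

open import Data.Empty using (⊥-elim)
open import Data.Integer as ℤ using (ℤ; +_; -[1+_]; +[1+_])
open import Data.Integer.Divisibility.Signed
  using ( divides; ∣ᵤ⇒∣; ∣⇒∣ᵤ; ∣-trans; ∣m⇒∣m*n; ∣n⇒∣m*n; ∣m∣n⇒∣m+n; ∣m+n∣n⇒∣m; ∣m⇒∣-m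
        ; *-monoˡ-∣; *-monoʳ-∣)
  renaming (_∣_ to _∣ℤ_; _∣?_ to _∣ℤ?_)
import Data.Integer.Properties as ℤ
import Data.Integer.Tactic.RingSolver as ℤ-Solver
open import Data.Nat using (zero; suc; _≤_)
import Data.Nat as ℕ
open import Data.Nat.Divisibility using (_∣_; _∣0; ∣1⇒≡1; m∣m*n; n∣m*n)
open import Data.Nat.Primality using (¬prime[1]; euclidsLemma; irreducible[2]; prime⇒nonZero)
import Data.Nat.Properties as ℕ
open import Data.Product using (proj₁; proj₂)
open import Data.Rational using (mkℚ; _-_; 1/_; toℚᵘ; ≢-nonZero)
open import Data.Rational.Properties
open import Data.Rational.Solver using (module +-*-Solver)
import Data.Rational.Unnormalised as ℚᵘ
import Data.Rational.Unnormalised.Properties as ℚᵘ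
open import Data.Sum using (inj₁; inj₂; [_,_]; [_,_]′)
import Data.Sum as Sum
open import Function using (_∘_; _⇔_; mk⇔; Equivalence)
open import Relation.Binary.PropositionalEquality
  using (refl; sym; trans; cong; cong₂; subst; subst₂; module ≡-Reasoning)
open import Relation.Nullary.Decidable using (yes; no)
open import Algebra.Properties.Group +-0-group
  using (x∙y⁻¹≈ε⇒x≈y; inverseˡ-unique)
  renaming (∙-cancelʳ to +-cancelʳ; ⁻¹-involutive to neg-involutive)

open +-*-Solver using (solve; _:+_; _:*_; :-_; _:-_; con; _:=_)

toℚᵘ-ℤtoℚ : ∀ x → toℚᵘ (ℤtoℚ x) ℚᵘ.≃ ℚᵘ.mkℚᵘ x 0
toℚᵘ-ℤtoℚ x = toℚᵘ-fromℚᵘ (ℚᵘ.mkℚᵘ x 0)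

ℤtoℚ-+ : ∀ x y → ℤtoℚ (x ℤ.+ y) ≡ ℤtoℚ x + ℤtoℚ y
ℤtoℚ-+ x y = toℚᵘ-injective (begin
  toℚᵘ (ℤtoℚ (x ℤ.+ y))             ≈⟨ toℚᵘ-ℤtoℚ (x ℤ.+ y) ⟩
  ℚᵘ.mkℚᵘ (x ℤ.+ y) 0               ≈⟨ ℚᵘ.*≡* (numerators x y) ⟩
  ℚᵘ.mkℚᵘ x 0 ℚᵘ.+ ℚᵘ.mkℚᵘ y 0      ≈⟨ ℚᵘ.+-cong (toℚᵘ-ℤtoℚ x) (toℚᵘ-ℤtoℚ y) ⟨
  toℚᵘ (ℤtoℚ x) ℚᵘ.+ toℚᵘ (ℤtoℚ y)  ≈⟨ toℚᵘ-homo-+ (ℤtoℚ x) (ℤtoℚ y) ⟨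
  toℚᵘ (ℤtoℚ x + ℤtoℚ y)            ∎)
  where
  open ℚᵘ.≃-Reasoning
  numerators : ∀ x y → (x ℤ.+ y) ℤ.* + 1 ≡ (x ℤ.* + 1 ℤ.+ y ℤ.* + 1) ℤ.* + 1
  numerators = ℤ-Solver.solve-∀

ℤtoℚ-* : ∀ x y → ℤtoℚ (x ℤ.* y) ≡ ℤtoℚ x * ℤtoℚ y
ℤtoℚ-* x y = toℚᵘ-injective (begin
  toℚᵘ (ℤtoℚ (x ℤ.* y))             ≈⟨ toℚᵘ-ℤtoℚ (x ℤ.* y) ⟩
  ℚᵘ.mkℚᵘ x 0 ℚᵘ.* ℚᵘ.mkℚᵘ y 0      ≈⟨ ℚᵘ.*-cong (toℚᵘ-ℤtoℚ x) (toℚᵘ-ℤtoℚ y) ⟨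
  toℚᵘ (ℤtoℚ x) ℚᵘ.* toℚᵘ (ℤtoℚ y)  ≈⟨ toℚᵘ-homo-* (ℤtoℚ x) (ℤtoℚ y) ⟨
  toℚᵘ (ℤtoℚ x * ℤtoℚ y)            ∎)
  where open ℚᵘ.≃-Reasoning

ℤtoℚ-neg : ∀ x → ℤtoℚ (ℤ.- x) ≡ - ℤtoℚ x
ℤtoℚ-neg x = toℚᵘ-injective (begin
  toℚᵘ (ℤtoℚ (ℤ.- x))  ≈⟨ toℚᵘ-ℤtoℚ (ℤ.- x) ⟩
  ℚᵘ.- ℚᵘ.mkℚᵘ x 0     ≈⟨ ℚᵘ.-‿cong (toℚᵘ-ℤtoℚ x) ⟨
  ℚᵘ.- toℚᵘ (ℤtoℚ x)   ≈⟨ toℚᵘ-homo‿- (ℤtoℚ x) ⟨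
  toℚᵘ (- ℤtoℚ x)      ∎)
  where open ℚᵘ.≃-Reasoning

ℤtoℚ-- : ∀ x y → ℤtoℚ (x ℤ.- y) ≡ ℤtoℚ x - ℤtoℚ y
ℤtoℚ-- x y = trans (ℤtoℚ-+ x (ℤ.- y)) (cong (λ t → ℤtoℚ x + t) (ℤtoℚ-neg y))

ℤtoℚ-injective : ∀ {x y} → ℤtoℚ x ≡ ℤtoℚ y → x ≡ y
ℤtoℚ-injective {x} {y} eq = begin
  x          ≡⟨ ℤ.*-identityʳ x ⟨
  x ℤ.* + 1  ≡⟨ ℚᵘ.drop-*≡* x≃y ⟩
  y ℤ.* + 1  ≡⟨ ℤ.*-identityʳ y ⟩
  y          ∎
  where
  open ≡-Reasoning
  x≃y : ℚᵘ.mkℚᵘ x 0 ℚᵘ.≃ ℚᵘ.mkℚᵘ y 0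
  x≃y = ℚᵘ.≃-trans (ℚᵘ.≃-sym (toℚᵘ-ℤtoℚ x)) (ℚᵘ.≃-trans (ℚᵘ.≃-reflexive (cong toℚᵘ eq)) (toℚᵘ-ℤtoℚ y))

ℕtoℚ-* : ∀ m n → ℕtoℚ (m ℕ.* n) ≡ ℕtoℚ m * ℕtoℚ n
ℕtoℚ-* m n = trans (cong ℤtoℚ (ℤ.pos-* m n)) (ℤtoℚ-* (+ m) (+ n))

p-p≡0 : ∀ p → p - p ≡ 0ℚ
p-p≡0 = solve 1 (λ p → p :- p := con 0ℚ) refl

p*q≡0⇒p≡0∨q≡0 : ∀ p q → p * q ≡ 0ℚ → p ≡ 0ℚ ⊎ q ≡ 0ℚ
p*q≡0⇒p≡0∨q≡0 p q pq≡0 with p ≟ 0ℚ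
... | yes p≡0 = inj₁ p≡0
... | no p≢0 = inj₂ (begin
  q               ≡⟨ *-identityˡ q ⟨
  1ℚ * q          ≡⟨ cong (_* q) (*-inverseˡ p) ⟨
  1/ p * p * q    ≡⟨ *-assoc (1/ p) p q ⟩
  1/ p * (p * q)  ≡⟨ cong (1/ p *_) pq≡0 ⟩
  1/ p * 0ℚ       ≡⟨ *-zeroʳ (1/ p) ⟩
  0ℚ              ∎)
  where
  open ≡-Reasoning
  instance _ = ≢-nonZero p≢0

*-cancelʳ-≡ : ∀ {p q} r → r ≢ 0ℚ → p * r ≡ q * r → p ≡ q
*-cancelʳ-≡ {p} {q} r r≢0 pr≡qr =
  [ x∙y⁻¹≈ε⇒x≈y p q , (λ r≡0 → ⊥-elim (r≢0 r≡0)) ] (p*q≡0⇒p≡0∨q≡0 (p - q) r [p-q]r≡0)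
  where
  open ≡-Reasoning
  distrib : ∀ p q r → (p - q) * r ≡ p * r - q * r
  distrib = solve 3 (λ p q r → (p :- q) :* r := p :* r :- q :* r) refl
  [p-q]r≡0 : (p - q) * r ≡ 0ℚ
  [p-q]r≡0 = begin
    (p - q) * r    ≡⟨ distrib p q r ⟩
    p * r - q * r  ≡⟨ cong (_- q * r) pr≡qr ⟩
    q * r - q * r  ≡⟨ p-p≡0 (q * r) ⟩
    0ℚ             ∎

p*p≡q*q⇒p≡±q : ∀ p q → p * p ≡ q * q → p ≡ q ⊎ p ≡ - q
p*p≡q*q⇒p≡±q p q pp≡qq =
  Sum.map (x∙y⁻¹≈ε⇒x≈y p q) (inverseˡ-unique p q) (p*q≡0⇒p≡0∨q≡0 (p - q) (p + q) [p-q][p+q]≡0)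
  where
  open ≡-Reasoning
  difference-of-squares : ∀ p q → (p - q) * (p + q) ≡ p * p - q * q
  difference-of-squares = solve 2 (λ p q → (p :- q) :* (p :+ q) := p :* p :- q :* q) refl
  [p-q][p+q]≡0 : (p - q) * (p + q) ≡ 0ℚ
  [p-q][p+q]≡0 = begin
    (p - q) * (p + q)  ≡⟨ difference-of-squares p q ⟩
    p * p - q * q      ≡⟨ cong (_- q * q) pp≡qq ⟩
    q * q - q * q      ≡⟨ p-p≡0 (q * q) ⟩
    0ℚ                 ∎

÷-≡⇔≡-* : ∀ A x y .{{_ : NonZero A}} → (x ÷ A ≡ y) ⇔ (x ≡ y * A)
÷-≡⇔≡-* A x y = mk⇔ to from
  where
  open ≡-Reasoning
  to : x ÷ A ≡ y → x ≡ y * A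
  to x÷A≡y = begin
    x               ≡⟨ *-identityʳ x ⟨
    x * 1ℚ          ≡⟨ cong (x *_) (*-inverseˡ A) ⟨
    x * (1/ A * A)  ≡⟨ *-assoc x (1/ A) A ⟨
    x ÷ A * A       ≡⟨ cong (_* A) x÷A≡y ⟩
    y * A           ∎
  from : x ≡ y * A → x ÷ A ≡ y
  from refl = begin
    y * A * 1/ A    ≡⟨ *-assoc y A (1/ A) ⟩
    y * (A * 1/ A)  ≡⟨ cong (y *_) (*-inverseʳ A) ⟩
    y * 1ℚ          ≡⟨ *-identityʳ y ⟩
    y               ∎

nonZero⇒≢0 : ∀ p .{{_ : NonZero p}} → p ≢ 0ℚ
nonZero⇒≢0 (mkℚ +[1+ _ ] _ _) ()
nonZero⇒≢0 (mkℚ -[1+ _ ] _ _) ()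

+-clear-denominators : ∀ x y a₁ a₂ d₁ d₂ → x * ℕtoℚ d₁ ≡ ℤtoℚ a₁ → y * ℕtoℚ d₂ ≡ ℤtoℚ a₂ →
                       (x + y) * ℕtoℚ (d₁ ℕ.* d₂) ≡ ℤtoℚ (a₁ ℤ.* + d₂ ℤ.+ a₂ ℤ.* + d₁)
+-clear-denominators x y a₁ a₂ d₁ d₂ xd₁≡a₁ yd₂≡a₂ = begin
  (x + y) * ℕtoℚ (d₁ ℕ.* d₂)
    ≡⟨ cong ((x + y) *_) (ℕtoℚ-* d₁ d₂) ⟩
  (x + y) * (ℕtoℚ d₁ * ℕtoℚ d₂)
    ≡⟨ expand x y (ℕtoℚ d₁) (ℕtoℚ d₂) ⟩
  x * ℕtoℚ d₁ * ℕtoℚ d₂ + y * ℕtoℚ d₂ * ℕtoℚ d₁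
    ≡⟨ cong₂ (λ s t → s * ℕtoℚ d₂ + t * ℕtoℚ d₁) xd₁≡a₁ yd₂≡a₂ ⟩
  ℤtoℚ a₁ * ℕtoℚ d₂ + ℤtoℚ a₂ * ℕtoℚ d₁
    ≡⟨ cong₂ _+_ (ℤtoℚ-* a₁ (+ d₂)) (ℤtoℚ-* a₂ (+ d₁)) ⟨
  ℤtoℚ (a₁ ℤ.* + d₂) + ℤtoℚ (a₂ ℤ.* + d₁)
    ≡⟨ ℤtoℚ-+ (a₁ ℤ.* + d₂) (a₂ ℤ.* + d₁) ⟨
  ℤtoℚ (a₁ ℤ.* + d₂ ℤ.+ a₂ ℤ.* + d₁)
    ∎
  where
  open ≡-Reasoning
  expand : ∀ x y d₁ d₂ → (x + y) * (d₁ * d₂) ≡ x * d₁ * d₂ + y * d₂ * d₁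
  expand = solve 4 (λ x y d₁ d₂ → (x :+ y) :* (d₁ :* d₂) := x :* d₁ :* d₂ :+ y :* d₂ :* d₁) refl

*-clear-denominators : ∀ x y a₁ a₂ d₁ d₂ → x * ℕtoℚ d₁ ≡ ℤtoℚ a₁ → y * ℕtoℚ d₂ ≡ ℤtoℚ a₂ →
                       x * y * ℕtoℚ (d₁ ℕ.* d₂) ≡ ℤtoℚ (a₁ ℤ.* a₂)
*-clear-denominators x y a₁ a₂ d₁ d₂ xd₁≡a₁ yd₂≡a₂ = begin
  x * y * ℕtoℚ (d₁ ℕ.* d₂)     ≡⟨ cong (x * y *_) (ℕtoℚ-* d₁ d₂) ⟩
  x * y * (ℕtoℚ d₁ * ℕtoℚ d₂)  ≡⟨ regroup x y (ℕtoℚ d₁) (ℕtoℚ d₂) ⟩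
  x * ℕtoℚ d₁ * (y * ℕtoℚ d₂)  ≡⟨ cong₂ _*_ xd₁≡a₁ yd₂≡a₂ ⟩
  ℤtoℚ a₁ * ℤtoℚ a₂            ≡⟨ ℤtoℚ-* a₁ a₂ ⟨
  ℤtoℚ (a₁ ℤ.* a₂)             ∎
  where
  open ≡-Reasoning
  regroup : ∀ x y d₁ d₂ → x * y * (d₁ * d₂) ≡ x * d₁ * (y * d₂)
  regroup = solve 4 (λ x y d₁ d₂ → x :* y :* (d₁ :* d₂) := x :* d₁ :* (y :* d₂)) refl

neg-clear-denominator : ∀ x a d → x * ℕtoℚ d ≡ ℤtoℚ a → - x * ℕtoℚ d ≡ ℤtoℚ (ℤ.- a)
neg-clear-denominator x a d xd≡a = begin
  - x * ℕtoℚ d    ≡⟨ neg-distribˡ-* x (ℕtoℚ d) ⟨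
  - (x * ℕtoℚ d)  ≡⟨ cong -_ xd≡a ⟩
  - ℤtoℚ a        ≡⟨ ℤtoℚ-neg a ⟨
  ℤtoℚ (ℤ.- a)    ∎
  where open ≡-Reasoning

-- The left-hand sides transcribe the products in Emat literally, so that the solver's
-- equation is definitionally the goal.
E21-Emat : ∀ b a → E21 (Emat b a) ≡ 1ℚ
E21-Emat = solve 2 (λ b a →
  (con 1ℚ :* a :+ con 0ℚ :* con 1ℚ) :* con 0ℚ :+ (con 1ℚ :* con 1ℚ :+ con 0ℚ :* con 0ℚ) :* con 1ℚ
  := con 1ℚ) refl

E12-Emat : ∀ b a → E12 (Emat b a) ≡ b * a + 1ℚ - b * b
E12-Emat = solve 2 (λ b a →
  (b :* a :+ con 1ℚ :* con 1ℚ) :* con 1ℚ :+ (b :* con 1ℚ :+ con 1ℚ :* con 0ℚ) :* :- b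
  := b :* a :+ con 1ℚ :- b :* b) refl

E22-E11-Emat : ∀ b a → E22 (Emat b a) - E11 (Emat b a) ≡ a - (b + b)
E22-E11-Emat = solve 2 (λ b a →
  (con 1ℚ :* a :+ con 0ℚ :* con 1ℚ) :* con 1ℚ :+ (con 1ℚ :* con 1ℚ :+ con 0ℚ :* con 0ℚ) :* :- b
  :- ((b :* a :+ con 1ℚ :* con 1ℚ) :* con 0ℚ :+ (b :* con 1ℚ :+ con 1ℚ :* con 0ℚ) :* con 1ℚ)
  := a :- (b :+ b)) refl

E12-Emat-double : ∀ b → E12 (Emat b (b + b)) ≡ b * b + 1ℚ
E12-Emat-double b = trans (E12-Emat b (b + b)) (simplify b)
  where
  simplify : ∀ b → b * (b + b) + 1ℚ - b * b ≡ b * b + 1ℚ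
  simplify = solve 1 (λ b → b :* (b :+ b) :+ con 1ℚ :- b :* b := b :* b :+ con 1ℚ) refl

E22-E11-Emat-double : ∀ b → E22 (Emat b (b + b)) - E11 (Emat b (b + b)) ≡ 0ℚ
E22-E11-Emat-double b = trans (E22-E11-Emat b (b + b)) (p-p≡0 (b + b))

module _ (A C : ℚ) .{{_ : NonZero A}} where

  inV₀⇒ : ∀ {b a} → InV A 0ℚ C b a → a ≡ b + b × (- C) ÷ A ≡ b * b + 1ℚ
  inV₀⇒ {b} {a} (eq-AB , eq-AC , _) = a≡b+b , Equivalence.from (÷-≡⇔≡-* A (- C) _) -C≡[b²+1]A
    where
    open ≡-Reasoning
    E = Emat b a
    a≡b+b : a ≡ b + b
    a≡b+b = x∙y⁻¹≈ε⇒x≈y a (b + b) (*-cancelʳ-≡ A (nonZero⇒≢0 A) (begin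
      (a - (b + b)) * A    ≡⟨ *-comm (a - (b + b)) A ⟩
      A * (a - (b + b))    ≡⟨ cong (A *_) (E22-E11-Emat b a) ⟨
      A * (E22 E - E11 E)  ≡⟨ eq-AB ⟩
      0ℚ * E21 E           ≡⟨ *-zeroˡ (E21 E) ⟩
      0ℚ                   ≡⟨ *-zeroˡ A ⟨
      0ℚ * A               ∎))
    -C≡[b²+1]A : - C ≡ (b * b + 1ℚ) * A
    -C≡[b²+1]A = begin
      - C                       ≡⟨ cong -_ (*-identityʳ C) ⟨
      - (C * 1ℚ)                ≡⟨ cong (λ t → - (C * t)) (E21-Emat b a) ⟨
      - (C * E21 E)             ≡⟨ cong -_ eq-AC ⟨
      - - (A * E12 E)           ≡⟨ neg-involutive (A * E12 E) ⟩
      A * E12 E                 ≡⟨ cong (λ a → A * E12 (Emat b a)) a≡b+b ⟩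
      A * E12 (Emat b (b + b))  ≡⟨ cong (A *_) (E12-Emat-double b) ⟩
      A * (b * b + 1ℚ)          ≡⟨ *-comm A (b * b + 1ℚ) ⟩
      (b * b + 1ℚ) * A          ∎

  inV₀-double : ∀ {b} → (- C) ÷ A ≡ b * b + 1ℚ → InV A 0ℚ C b (b + b)
  inV₀-double {b} -C÷A≡b²+1 = eq-AB , eq-AC , eq-BC
    where
    open ≡-Reasoning
    E = Emat b (b + b)
    eq-AB : A * (E22 E - E11 E) ≡ 0ℚ * E21 E
    eq-AB = begin
      A * (E22 E - E11 E)  ≡⟨ cong (A *_) (E22-E11-Emat-double b) ⟩
      A * 0ℚ               ≡⟨ *-zeroʳ A ⟩
      0ℚ                   ≡⟨ *-zeroˡ (E21 E) ⟨
      0ℚ * E21 E           ∎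
    eq-AC : - (A * E12 E) ≡ C * E21 E
    eq-AC = begin
      - (A * E12 E)         ≡⟨ cong (λ t → - (A * t)) (E12-Emat-double b) ⟩
      - (A * (b * b + 1ℚ))  ≡⟨ cong -_ (*-comm A (b * b + 1ℚ)) ⟩
      - ((b * b + 1ℚ) * A)  ≡⟨ cong -_ (Equivalence.to (÷-≡⇔≡-* A (- C) _) -C÷A≡b²+1) ⟨
      - - C                 ≡⟨ neg-involutive C ⟩
      C                     ≡⟨ *-identityʳ C ⟨
      C * 1ℚ                ≡⟨ cong (C *_) (E21-Emat b (b + b)) ⟨
      C * E21 E             ∎
    eq-BC : - (0ℚ * E12 E) ≡ C * (E22 E - E11 E)
    eq-BC = begin
      - (0ℚ * E12 E)       ≡⟨ cong -_ (*-zeroˡ (E12 E)) ⟩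
      0ℚ                   ≡⟨ *-zeroʳ C ⟨
      C * 0ℚ               ≡⟨ cong (C *_) (E22-E11-Emat-double b) ⟨
      C * (E22 E - E11 E)  ∎

det : (ℕ → ℚ) → ℕ → ℚ
det c n = Aₙ c n * Bₙ c (suc n) - Bₙ c n * Aₙ c (suc n)

det-suc : ∀ c n → det c (suc n) ≡ - det c n
det-suc c n = identity (c (suc (suc n))) (Aₙ c n) (Aₙ c (suc n)) (Bₙ c n) (Bₙ c (suc n))
  where
  identity : ∀ x a₀ a₁ b₀ b₁ → a₁ * (x * b₁ + b₀) - b₁ * (x * a₁ + a₀) ≡ - (a₀ * b₁ - b₀ * a₁)
  identity = solve 5 (λ x a₀ a₁ b₀ b₁ →
    a₁ :* (x :* b₁ :+ b₀) :- b₁ :* (x :* a₁ :+ a₀) := :- (a₀ :* b₁ :- b₀ :* a₁)) refl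

det*det≡1 : ∀ c n → det c n * det c n ≡ 1ℚ
det*det≡1 c zero = initial (c 1)
  where
  initial : ∀ x → (1ℚ * 1ℚ - 0ℚ * x) * (1ℚ * 1ℚ - 0ℚ * x) ≡ 1ℚ
  initial = solve 1 (λ x →
    (con 1ℚ :* con 1ℚ :- con 0ℚ :* x) :* (con 1ℚ :* con 1ℚ :- con 0ℚ :* x) := con 1ℚ) refl
det*det≡1 c (suc n) = begin
  det c (suc n) * det c (suc n)  ≡⟨ cong (λ t → t * t) (det-suc c n) ⟩
  - det c n * - det c n          ≡⟨ neg-square (det c n) ⟩
  det c n * det c n              ≡⟨ det*det≡1 c n ⟩
  1ℚ                             ∎
  where
  open ≡-Reasoning
  neg-square : ∀ x → - x * - x ≡ x * x
  neg-square = solve 1 (λ x → :- x :* :- x := x :* x) refl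

InO-+ : ∀ {p x y} → InO p x → InO p y → InO p (x + y)
InO-+ {p} {x} {y} (k₁ , a₁ , xpᵏ¹≡a₁) (k₂ , a₂ , ypᵏ²≡a₂) =
  k₁ ℕ.+ k₂ , a , subst (λ d → (x + y) * ℕtoℚ d ≡ ℤtoℚ a) (sym (ℕ.^-distribˡ-+-* p k₁ k₂))
                        (+-clear-denominators x y a₁ a₂ (p ℕ.^ k₁) (p ℕ.^ k₂) xpᵏ¹≡a₁ ypᵏ²≡a₂)
  where
  a : ℤ
  a = a₁ ℤ.* + (p ℕ.^ k₂) ℤ.+ a₂ ℤ.* + (p ℕ.^ k₁)

InO-neg : ∀ {p x} → InO p x → InO p (- x)
InO-neg {p} {x} (k , a , xpᵏ≡a) = k , ℤ.- a , neg-clear-denominator x a (p ℕ.^ k) xpᵏ≡a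

record PIntegral (p : ℕ) (q : ℚ) : Set where
  constructor mkPIntegral
  field
    numerator               : ℤ
    denominator             : ℕ
    p∤denominator           : ¬ p ∣ denominator
    q*denominator≡numerator : q * ℕtoℚ denominator ≡ ℤtoℚ numerator

p∤d⇒d≢0 : ∀ {p d} → ¬ p ∣ d → d ≢ 0
p∤d⇒d≢0 {p} p∤d refl = p∤d (p ∣0)

absLeMul₀⇔pIntegral : ∀ {p q} → AbsLeMul p 0 q 1ℚ ⇔ PIntegral p q
absLeMul₀⇔pIntegral = mk⇔
  (λ (a , d , _ , p∤d , eq) → mkPIntegral a d p∤d (trans eq (a*1*1≡a a)))
  (λ (mkPIntegral a d p∤d eq) → a , d , p∤d⇒d≢0 p∤d , p∤d , trans eq (sym (a*1*1≡a a)))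
  where
  a*1*1≡a : ∀ a → ℤtoℚ a * 1ℚ * 1ℚ ≡ ℤtoℚ a
  a*1*1≡a a = trans (*-identityʳ (ℤtoℚ a * 1ℚ)) (*-identityʳ (ℤtoℚ a))

pIntegral-neg : ∀ {p x} → PIntegral p x → PIntegral p (- x)
pIntegral-neg {x = x} (mkPIntegral a d p∤d xd≡a) =
  mkPIntegral (ℤ.- a) d p∤d (neg-clear-denominator x a d xd≡a)

type11-pIntegral : ∀ {p b a} → PIntegral p b → PIntegral p a → ∀ n → PIntegral p (type11 b a n)
type11-pIntegral b-int a-int zero = b-int
type11-pIntegral b-int a-int (suc zero) = b-int
type11-pIntegral b-int a-int (suc (suc n)) = a-int

module _ {p : ℕ} (p-prime : Prime p) where

  p∤1 : ¬ p ∣ 1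
  p∤1 p∣1 = ¬prime[1] (subst Prime (∣1⇒≡1 p∣1) p-prime)

  p∤m∧p∤n⇒p∤m*n : ∀ {m n} → ¬ p ∣ m → ¬ p ∣ n → ¬ p ∣ m ℕ.* n
  p∤m∧p∤n⇒p∤m*n p∤m p∤n p∣mn = [ p∤m , p∤n ] (euclidsLemma _ _ p-prime p∣mn)

  p∤i∧p∤j⇒p∤i*j : ∀ {i j} → ¬ + p ∣ℤ i → ¬ + p ∣ℤ j → ¬ + p ∣ℤ i ℤ.* j
  p∤i∧p∤j⇒p∤i*j {i} {j} p∤i p∤j p∣ij =
    p∤m∧p∤n⇒p∤m*n (p∤i ∘ ∣ᵤ⇒∣) (p∤j ∘ ∣ᵤ⇒∣) (subst (p ∣_) (ℤ.abs-* i j) (∣⇒∣ᵤ p∣ij))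

  pIntegral-ℤtoℚ : ∀ a → PIntegral p (ℤtoℚ a)
  pIntegral-ℤtoℚ a = mkPIntegral a 1 p∤1 (*-identityʳ (ℤtoℚ a))

  pIntegral-+ : ∀ {x y} → PIntegral p x → PIntegral p y → PIntegral p (x + y)
  pIntegral-+ {x} {y} (mkPIntegral a₁ d₁ p∤d₁ xd₁≡a₁) (mkPIntegral a₂ d₂ p∤d₂ yd₂≡a₂) =
    mkPIntegral (a₁ ℤ.* + d₂ ℤ.+ a₂ ℤ.* + d₁) (d₁ ℕ.* d₂) (p∤m∧p∤n⇒p∤m*n p∤d₁ p∤d₂)
                (+-clear-denominators x y a₁ a₂ d₁ d₂ xd₁≡a₁ yd₂≡a₂)

  pIntegral-* : ∀ {x y} → PIntegral p x → PIntegral p y → PIntegral p (x * y)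
  pIntegral-* {x} {y} (mkPIntegral a₁ d₁ p∤d₁ xd₁≡a₁) (mkPIntegral a₂ d₂ p∤d₂ yd₂≡a₂) =
    mkPIntegral (a₁ ℤ.* a₂) (d₁ ℕ.* d₂) (p∤m∧p∤n⇒p∤m*n p∤d₁ p∤d₂)
                (*-clear-denominators x y a₁ a₂ d₁ d₂ xd₁≡a₁ yd₂≡a₂)

  pIntegral-- : ∀ {x y} → PIntegral p x → PIntegral p y → PIntegral p (x - y)
  pIntegral-- x-int y-int = pIntegral-+ x-int (pIntegral-neg y-int)

  convergents-pIntegral : ∀ {c} → (∀ n → PIntegral p (c n)) →
                          ∀ n → PIntegral p (Aₙ c n) × PIntegral p (Bₙ c n)
  convergents-pIntegral c-int zero = pIntegral-ℤtoℚ (+ 1) , pIntegral-ℤtoℚ (+ 0)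
  convergents-pIntegral c-int (suc zero) = c-int 1 , pIntegral-ℤtoℚ (+ 1)
  convergents-pIntegral {c} c-int (suc (suc n)) =
    let A₁ , B₁ = convergents-pIntegral c-int (suc n)
        A₀ , B₀ = convergents-pIntegral c-int n
    in next A₁ A₀ , next B₁ B₀
    where
    next : ∀ {x y} → PIntegral p x → PIntegral p y → PIntegral p (c (suc (suc n)) * x + y)
    next x-int y-int = pIntegral-+ (pIntegral-* (c-int (suc (suc n))) x-int) y-int

  -- Multiplying u d = a pᵏ⁺¹ y by u exhibits the p-free number d d′ as a multiple of p.
  unit⇒¬absLeMul : ∀ {k u y} → PIntegral p u → u * u ≡ 1ℚ → PIntegral p y →
                   ¬ AbsLeMul p (suc k) u y
  unit⇒¬absLeMul {k} {u} {y} u-int u*u≡1 y-int = ¬absLeMul (pIntegral-* u-int y-int)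
    where
    pᵏ⁺¹ : ℤ
    pᵏ⁺¹ = + (p ℕ.^ suc k)
    regroup₁ : ∀ u d d′ → u * u * (d * d′) ≡ u * (u * d) * d′
    regroup₁ = solve 3 (λ u d d′ → u :* u :* (d :* d′) := u :* (u :* d) :* d′) refl
    regroup₂ : ∀ u a q y d′ → u * (a * q * y) * d′ ≡ a * q * (u * y * d′)
    regroup₂ = solve 5 (λ u a q y d′ → u :* (a :* q :* y) :* d′ := a :* q :* (u :* y :* d′)) refl
    ¬absLeMul : PIntegral p (u * y) → ¬ AbsLeMul p (suc k) u y
    ¬absLeMul (mkPIntegral a′ d′ p∤d′ uyd′≡a′) (a , d , _ , p∤d , ud≡apy) =
      p∤m∧p∤n⇒p∤m*n p∤d p∤d′ (∣⇒∣ᵤ (subst (+ p ∣ℤ_) (sym dd′≡apa′) p∣apa′))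
      where
      open ≡-Reasoning
      dd′≡apa′ : + (d ℕ.* d′) ≡ a ℤ.* pᵏ⁺¹ ℤ.* a′
      dd′≡apa′ = ℤtoℚ-injective (begin
        ℕtoℚ (d ℕ.* d′)                         ≡⟨ ℕtoℚ-* d d′ ⟩
        ℕtoℚ d * ℕtoℚ d′                        ≡⟨ *-identityˡ _ ⟨
        1ℚ * (ℕtoℚ d * ℕtoℚ d′)                 ≡⟨ cong (_* (ℕtoℚ d * ℕtoℚ d′)) u*u≡1 ⟨
        u * u * (ℕtoℚ d * ℕtoℚ d′)              ≡⟨ regroup₁ u (ℕtoℚ d) (ℕtoℚ d′) ⟩
        u * (u * ℕtoℚ d) * ℕtoℚ d′              ≡⟨ cong (λ t → u * t * ℕtoℚ d′) ud≡apy ⟩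
        u * (ℤtoℚ a * ℤtoℚ pᵏ⁺¹ * y) * ℕtoℚ d′  ≡⟨ regroup₂ u (ℤtoℚ a) (ℤtoℚ pᵏ⁺¹) y (ℕtoℚ d′) ⟩
        ℤtoℚ a * ℤtoℚ pᵏ⁺¹ * (u * y * ℕtoℚ d′)  ≡⟨ cong (ℤtoℚ a * ℤtoℚ pᵏ⁺¹ *_) uyd′≡a′ ⟩
        ℤtoℚ a * ℤtoℚ pᵏ⁺¹ * ℤtoℚ a′            ≡⟨ cong (_* ℤtoℚ a′) (ℤtoℚ-* a pᵏ⁺¹) ⟨
        ℤtoℚ (a ℤ.* pᵏ⁺¹) * ℤtoℚ a′             ≡⟨ ℤtoℚ-* (a ℤ.* pᵏ⁺¹) a′ ⟨
        ℤtoℚ (a ℤ.* pᵏ⁺¹ ℤ.* a′)                ∎)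
      p∣apa′ : + p ∣ℤ a ℤ.* pᵏ⁺¹ ℤ.* a′
      p∣apa′ = ∣m⇒∣m*n a′ (∣n⇒∣m*n a (∣ᵤ⇒∣ (m∣m*n (p ℕ.^ k))))

  pIntegral⇒¬converges : ∀ {c} → (∀ n → PIntegral p (c n)) → ¬ PAdicConverges p c
  pIntegral⇒¬converges {c} c-int converges =
    ¬chord (proj₂ (converges 1) N (suc N) ℕ.≤-refl (ℕ.n≤1+n N))
    where
    N : ℕ
    N = proj₁ (converges 1)
    A-int : ∀ n → PIntegral p (Aₙ c n)
    A-int n = proj₁ (convergents-pIntegral c-int n)
    B-int : ∀ n → PIntegral p (Bₙ c n)
    B-int n = proj₂ (convergents-pIntegral c-int n)
    det-int : PIntegral p (det c N)
    det-int = pIntegral-- (pIntegral-* (A-int N) (B-int (suc N)))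
                          (pIntegral-* (B-int N) (A-int (suc N)))
    ¬absLeMul-det : ∀ {y} → PIntegral p y → ¬ AbsLeMul p 1 (det c N) y
    ¬absLeMul-det = unit⇒¬absLeMul {k = 0} det-int (det*det≡1 c N)
    ¬chord : ¬ ChordLe p 1 (convergent c N) (convergent c (suc N))
    ¬chord (inj₁ h)               = ¬absLeMul-det (pIntegral-* (A-int N) (A-int (suc N))) h
    ¬chord (inj₂ (inj₁ h))        = ¬absLeMul-det (pIntegral-* (A-int N) (B-int (suc N))) h
    ¬chord (inj₂ (inj₂ (inj₁ h))) = ¬absLeMul-det (pIntegral-* (B-int N) (A-int (suc N))) h
    ¬chord (inj₂ (inj₂ (inj₂ h))) = ¬absLeMul-det (pIntegral-* (B-int N) (B-int (suc N))) h

  pᵏ∣pᵐ : ∀ {k m} → k ≤ m → + (p ℕ.^ k) ∣ℤ + (p ℕ.^ m)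
  pᵏ∣pᵐ {k} {m} k≤m = ∣ᵤ⇒∣ (subst (p ℕ.^ k ∣_) pᵐ⁻ᵏpᵏ≡pᵐ (n∣m*n (p ℕ.^ (m ℕ.∸ k))))
    where
    pᵐ⁻ᵏpᵏ≡pᵐ : p ℕ.^ (m ℕ.∸ k) ℕ.* p ℕ.^ k ≡ p ℕ.^ m
    pᵐ⁻ᵏpᵏ≡pᵐ = trans (sym (ℕ.^-distribˡ-+-* p (m ℕ.∸ k) k)) (cong (p ℕ.^_) (ℕ.m∸n+n≡m k≤m))

  -- From x r = q pᵏ and y r = u one reads off x ∣u∣² = (q u) pᵏ y, and p ∤ ∣u∣².
  scaling⇒absLeMul : ∀ {k w u} x y r → r ≢ 0ℚ → + (p ℕ.^ k) ∣ℤ w → ¬ + p ∣ℤ u →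
                     x * r ≡ ℤtoℚ w → y * r ≡ ℤtoℚ u → AbsLeMul p k x y
  scaling⇒absLeMul {k} {w} {u} x y r r≢0 (divides q w≡qpᵏ) p∤u xr≡w yr≡u =
    q ℤ.* u , ∣u∣² , p∤d⇒d≢0 p∤∣u∣² , p∤∣u∣² , *-cancelʳ-≡ r r≢0 (begin
      x * ℕtoℚ ∣u∣² * r                   ≡⟨ swap x (ℕtoℚ ∣u∣²) r ⟩
      x * r * ℕtoℚ ∣u∣²                   ≡⟨ cong₂ _*_ xr≡w (cong ℤtoℚ (+∣i∣*∣i∣≡i*i u)) ⟩
      ℤtoℚ w * ℤtoℚ (u ℤ.* u)             ≡⟨ ℤtoℚ-* w (u ℤ.* u) ⟨
      ℤtoℚ (w ℤ.* (u ℤ.* u))              ≡⟨ cong ℤtoℚ wu²≡qupᵏu ⟩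
      ℤtoℚ (q ℤ.* u ℤ.* pᵏ ℤ.* u)         ≡⟨ ℤtoℚ-* (q ℤ.* u ℤ.* pᵏ) u ⟩
      ℤtoℚ (q ℤ.* u ℤ.* pᵏ) * ℤtoℚ u      ≡⟨ cong (_* ℤtoℚ u) (ℤtoℚ-* (q ℤ.* u) pᵏ) ⟩
      ℤtoℚ (q ℤ.* u) * ℤtoℚ pᵏ * ℤtoℚ u   ≡⟨ cong (ℤtoℚ (q ℤ.* u) * ℤtoℚ pᵏ *_) yr≡u ⟨
      ℤtoℚ (q ℤ.* u) * ℤtoℚ pᵏ * (y * r)  ≡⟨ *-assoc (ℤtoℚ (q ℤ.* u) * ℤtoℚ pᵏ) y r ⟨
      ℤtoℚ (q ℤ.* u) * ℤtoℚ pᵏ * y * r    ∎)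
    where
    open ≡-Reasoning
    pᵏ : ℤ
    pᵏ = + (p ℕ.^ k)
    ∣u∣² : ℕ
    ∣u∣² = ℤ.∣ u ∣ ℕ.* ℤ.∣ u ∣
    p∤∣u∣² : ¬ p ∣ ∣u∣²
    p∤∣u∣² = p∤m∧p∤n⇒p∤m*n (p∤u ∘ ∣ᵤ⇒∣) (p∤u ∘ ∣ᵤ⇒∣)
    +∣i∣*∣i∣≡i*i : ∀ i → + (ℤ.∣ i ∣ ℕ.* ℤ.∣ i ∣) ≡ i ℤ.* i
    +∣i∣*∣i∣≡i*i (+ n) = ℤ.pos-* n n
    +∣i∣*∣i∣≡i*i -[1+ n ] = refl
    swap : ∀ x d r → x * d * r ≡ x * r * d
    swap = solve 3 (λ x d r → x :* d :* r := x :* r :* d) refl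
    regroupℤ : ∀ q pᵏ u → q ℤ.* pᵏ ℤ.* (u ℤ.* u) ≡ q ℤ.* u ℤ.* pᵏ ℤ.* u
    regroupℤ = ℤ-Solver.solve-∀
    wu²≡qupᵏu : w ℤ.* (u ℤ.* u) ≡ q ℤ.* u ℤ.* pᵏ ℤ.* u
    wu²≡qupᵏu = trans (cong (ℤ._* (u ℤ.* u)) w≡qpᵏ) (regroupℤ q pᵏ u)

  -- Every partial quotient is c n = z n / P with z n a p-adic unit and p ∣ P,
  -- i.e. all of them have the same absolute value |P|ₚ⁻¹ > 1.
  module EqualLargeQuotients
    (P : ℤ) (p∣P : + p ∣ℤ P) (c : ℕ → ℚ) (z : ℕ → ℤ)
    (cP≡z : ∀ n → c n * ℤtoℚ P ≡ ℤtoℚ (z n)) (p∤z : ∀ n → ¬ + p ∣ℤ z n)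
    where

    scaled : ℤ → ℤ → ℕ → ℤ
    scaled x₀ x₁ zero = x₀
    scaled x₀ x₁ (suc zero) = x₁
    scaled x₀ x₁ (suc (suc n)) = z (suc (suc n)) ℤ.* scaled x₀ x₁ (suc n) ℤ.+ P ℤ.* P ℤ.* scaled x₀ x₁ n

    scaled-step : ∀ {X₀ X₁ X₂ : ℚ} {s₀ s₁} n → X₂ ≡ c (suc (suc n)) * X₁ + X₀ →
                  X₀ * ℤtoℚ (P ℤ.^ n) ≡ ℤtoℚ s₀ → X₁ * ℤtoℚ (P ℤ.^ suc n) ≡ ℤtoℚ s₁ →
                  X₂ * ℤtoℚ (P ℤ.^ suc (suc n)) ≡ ℤtoℚ (z (suc (suc n)) ℤ.* s₁ ℤ.+ P ℤ.* P ℤ.* s₀)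
    scaled-step {X₀} {X₁} {X₂} {s₀} {s₁} n X₂≡ X₀-scaled X₁-scaled = begin
      X₂ * ℤtoℚ (P ℤ.* (P ℤ.* Pⁿ))
        ≡⟨ cong₂ _*_ X₂≡ (trans (ℤtoℚ-* P (P ℤ.* Pⁿ)) (cong (ℤtoℚ P *_) (ℤtoℚ-* P Pⁿ))) ⟩
      (c′ * X₁ + X₀) * (ℤtoℚ P * (ℤtoℚ P * ℤtoℚ Pⁿ))
        ≡⟨ expand c′ X₁ X₀ (ℤtoℚ P) (ℤtoℚ Pⁿ) ⟩
      c′ * ℤtoℚ P * (X₁ * (ℤtoℚ P * ℤtoℚ Pⁿ)) + ℤtoℚ P * ℤtoℚ P * (X₀ * ℤtoℚ Pⁿ)
        ≡⟨ cong₂ _+_ (cong₂ _*_ (cP≡z (suc (suc n))) X₁-scaled′) (cong (ℤtoℚ P * ℤtoℚ P *_) X₀-scaled) ⟩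
      ℤtoℚ (z (suc (suc n))) * ℤtoℚ s₁ + ℤtoℚ P * ℤtoℚ P * ℤtoℚ s₀
        ≡⟨ cong₂ _+_ (ℤtoℚ-* (z (suc (suc n))) s₁)
                     (trans (ℤtoℚ-* (P ℤ.* P) s₀) (cong (_* ℤtoℚ s₀) (ℤtoℚ-* P P))) ⟨
      ℤtoℚ (z (suc (suc n)) ℤ.* s₁) + ℤtoℚ (P ℤ.* P ℤ.* s₀)
        ≡⟨ ℤtoℚ-+ (z (suc (suc n)) ℤ.* s₁) (P ℤ.* P ℤ.* s₀) ⟨
      ℤtoℚ (z (suc (suc n)) ℤ.* s₁ ℤ.+ P ℤ.* P ℤ.* s₀)
        ∎
      where
      open ≡-Reasoning
      c′ = c (suc (suc n))
      Pⁿ = P ℤ.^ n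
      X₁-scaled′ : X₁ * (ℤtoℚ P * ℤtoℚ Pⁿ) ≡ ℤtoℚ s₁
      X₁-scaled′ = trans (cong (X₁ *_) (sym (ℤtoℚ-* P Pⁿ))) X₁-scaled
      expand : ∀ c x₁ x₀ P Pⁿ →
               (c * x₁ + x₀) * (P * (P * Pⁿ)) ≡ c * P * (x₁ * (P * Pⁿ)) + P * P * (x₀ * Pⁿ)
      expand = solve 5 (λ c x₁ x₀ P Pⁿ →
        (c :* x₁ :+ x₀) :* (P :* (P :* Pⁿ)) := c :* P :* (x₁ :* (P :* Pⁿ)) :+ P :* P :* (x₀ :* Pⁿ)) refl

    scaled-correct : ∀ (X : ℕ → ℚ) {x₀ x₁} →
                     (∀ n → X (suc (suc n)) ≡ c (suc (suc n)) * X (suc n) + X n) →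
                     X 0 ≡ ℤtoℚ x₀ → X 1 * ℤtoℚ P ≡ ℤtoℚ x₁ →
                     ∀ n → X n * ℤtoℚ (P ℤ.^ n) ≡ ℤtoℚ (scaled x₀ x₁ n)
    scaled-correct X X-rec X₀≡ X₁P≡ zero = trans (*-identityʳ (X 0)) X₀≡
    scaled-correct X X-rec X₀≡ X₁P≡ (suc zero) = trans (cong (λ t → X 1 * ℤtoℚ t) (ℤ.*-identityʳ P)) X₁P≡
    scaled-correct X X-rec X₀≡ X₁P≡ (suc (suc n)) =
      scaled-step n (X-rec n) (scaled-correct X X-rec X₀≡ X₁P≡ n)
                              (scaled-correct X X-rec X₀≡ X₁P≡ (suc n))

    Â B̂ : ℕ → ℤ
    Â = scaled (+ 1) (z 1)
    B̂ = scaled (+ 0) P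

    Â-correct : ∀ n → Aₙ c n * ℤtoℚ (P ℤ.^ n) ≡ ℤtoℚ (Â n)
    Â-correct = scaled-correct (Aₙ c) (λ _ → refl) refl (cP≡z 1)

    B̂-correct : ∀ n → Bₙ c n * ℤtoℚ (P ℤ.^ n) ≡ ℤtoℚ (B̂ n)
    B̂-correct = scaled-correct (Bₙ c) (λ _ → refl) refl (*-identityˡ (ℤtoℚ P))

    p∤Â : ∀ n → ¬ + p ∣ℤ Â n
    p∤Â zero = p∤1 ∘ ∣⇒∣ᵤ
    p∤Â (suc zero) = p∤z 1
    p∤Â (suc (suc n)) p∣Â = p∤i∧p∤j⇒p∤i*j (p∤z (suc (suc n))) (p∤Â (suc n))
      (∣m+n∣n⇒∣m p∣Â (∣m⇒∣m*n (Â n) (∣m⇒∣m*n P p∣P)))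

    W : ℕ → ℕ → ℤ
    W m n = Â m ℤ.* B̂ n ℤ.- B̂ m ℤ.* Â n

    W-diag : ∀ m → W m m ≡ + 0
    W-diag m = identity (Â m) (B̂ m)
      where
      identity : ∀ a b → a ℤ.* b ℤ.- b ℤ.* a ≡ + 0
      identity = ℤ-Solver.solve-∀

    W-antisym : ∀ m n → W n m ≡ ℤ.- W m n
    W-antisym m n = identity (Â m) (B̂ m) (Â n) (B̂ n)
      where
      identity : ∀ a b a′ b′ → a′ ℤ.* b ℤ.- b′ ℤ.* a ≡ ℤ.- (a ℤ.* b′ ℤ.- b ℤ.* a′)
      identity = ℤ-Solver.solve-∀

    W-rec : ∀ m n → W m (suc (suc n)) ≡ z (suc (suc n)) ℤ.* W m (suc n) ℤ.+ P ℤ.* P ℤ.* W m n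
    W-rec m n = identity (z (suc (suc n))) P (Â m) (B̂ m) (Â n) (B̂ n) (Â (suc n)) (B̂ (suc n))
      where
      identity : ∀ x P a b a₀ b₀ a₁ b₁ →
                 a ℤ.* (x ℤ.* b₁ ℤ.+ P ℤ.* P ℤ.* b₀) ℤ.- b ℤ.* (x ℤ.* a₁ ℤ.+ P ℤ.* P ℤ.* a₀)
                 ≡ x ℤ.* (a ℤ.* b₁ ℤ.- b ℤ.* a₁) ℤ.+ P ℤ.* P ℤ.* (a ℤ.* b₀ ℤ.- b ℤ.* a₀)
      identity = ℤ-Solver.solve-∀

    W-suc : ∀ m → W (suc m) (suc (suc m)) ≡ ℤ.- (P ℤ.* P ℤ.* W m (suc m))
    W-suc m = identity (z (suc (suc m))) P (Â m) (B̂ m) (Â (suc m)) (B̂ (suc m))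
      where
      identity : ∀ x P a₀ b₀ a₁ b₁ →
                 a₁ ℤ.* (x ℤ.* b₁ ℤ.+ P ℤ.* P ℤ.* b₀) ℤ.- b₁ ℤ.* (x ℤ.* a₁ ℤ.+ P ℤ.* P ℤ.* a₀)
                 ≡ ℤ.- (P ℤ.* P ℤ.* (a₀ ℤ.* b₁ ℤ.- b₀ ℤ.* a₁))
      identity = ℤ-Solver.solve-∀

    pᵐ∣W-suc : ∀ m → + (p ℕ.^ m) ∣ℤ W m (suc m)
    pᵐ∣W-suc zero = divides (W 0 1) (sym (ℤ.*-identityʳ (W 0 1)))
    pᵐ∣W-suc (suc m) = subst (+ (p ℕ.^ suc m) ∣ℤ_) (sym (W-suc m)) (∣m⇒∣-m pᵐ⁺¹∣P²W)
      where
      pᵐ⁺¹∣P²W : + (p ℕ.^ suc m) ∣ℤ P ℤ.* P ℤ.* W m (suc m)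
      pᵐ⁺¹∣P²W = subst₂ _∣ℤ_ (sym (ℤ.pos-* p (p ℕ.^ m))) (sym (ℤ.*-assoc P P (W m (suc m))))
        (∣-trans (*-monoˡ-∣ (+ (p ℕ.^ m)) p∣P) (*-monoʳ-∣ P (∣n⇒∣m*n P (pᵐ∣W-suc m))))

    pᵐ∣W : ∀ m j → + (p ℕ.^ m) ∣ℤ W m (j ℕ.+ m)
    pᵐ∣W m zero = subst (+ (p ℕ.^ m) ∣ℤ_) (sym (W-diag m)) (divides (+ 0) refl)
    pᵐ∣W m (suc zero) = pᵐ∣W-suc m
    pᵐ∣W m (suc (suc j)) = subst (+ (p ℕ.^ m) ∣ℤ_) (sym (W-rec m (j ℕ.+ m)))
      (∣m∣n⇒∣m+n (∣n⇒∣m*n (z (suc (suc (j ℕ.+ m)))) (pᵐ∣W m (suc j))) (∣n⇒∣m*n (P ℤ.* P) (pᵐ∣W m j)))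

    pᵏ∣W-ordered : ∀ {k m n} → k ≤ m → m ≤ n → + (p ℕ.^ k) ∣ℤ W m n
    pᵏ∣W-ordered {k} {m} {n} k≤m m≤n =
      ∣-trans (pᵏ∣pᵐ k≤m) (subst (λ j → + (p ℕ.^ m) ∣ℤ W m j) (ℕ.m∸n+n≡m m≤n) (pᵐ∣W m (n ℕ.∸ m)))

    pᵏ∣W : ∀ {k} m n → k ≤ m → k ≤ n → + (p ℕ.^ k) ∣ℤ W m n
    pᵏ∣W m n k≤m k≤n = [ pᵏ∣W-ordered k≤m
                        , (λ n≤m → subst (_ ∣ℤ_) (sym (W-antisym n m)) (∣m⇒∣-m (pᵏ∣W-ordered k≤n n≤m)))
                        ]′ (ℕ.≤-total m n)

    P≢0 : P ≢ + 0
    P≢0 P≡0 = p∤z 0 (subst (+ p ∣ℤ_) 0≡z₀ (divides (+ 0) refl))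
      where
      open ≡-Reasoning
      0≡z₀ : + 0 ≡ z 0
      0≡z₀ = ℤtoℚ-injective (begin
        0ℚ            ≡⟨ *-zeroʳ (c 0) ⟨
        c 0 * 0ℚ      ≡⟨ cong (λ t → c 0 * ℤtoℚ t) P≡0 ⟨
        c 0 * ℤtoℚ P  ≡⟨ cP≡z 0 ⟩
        ℤtoℚ (z 0)    ∎)

    Pᵐ*Pⁿ≢0 : ∀ m n → ℤtoℚ (P ℤ.^ m) * ℤtoℚ (P ℤ.^ n) ≢ 0ℚ
    Pᵐ*Pⁿ≢0 m n PᵐPⁿ≡0 = [ Pⁱ≢0 m , Pⁱ≢0 n ] (p*q≡0⇒p≡0∨q≡0 _ _ PᵐPⁿ≡0)
      where
      Pⁱ≢0 : ∀ i → ℤtoℚ (P ℤ.^ i) ≢ 0ℚ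
      Pⁱ≢0 i Pⁱ≡0 = P≢0 (ℤ.i^n≡0⇒i≡0 P i (ℤtoℚ-injective {y = + 0} Pⁱ≡0))

    det-scaled : ∀ m n → (Aₙ c m * Bₙ c n - Bₙ c m * Aₙ c n) * (ℤtoℚ (P ℤ.^ m) * ℤtoℚ (P ℤ.^ n))
                         ≡ ℤtoℚ (W m n)
    det-scaled m n = begin
      (Aₙ c m * Bₙ c n - Bₙ c m * Aₙ c n) * (Pᵐ * Pⁿ)
        ≡⟨ distribute (Aₙ c m) (Bₙ c m) (Aₙ c n) (Bₙ c n) Pᵐ Pⁿ ⟩
      Aₙ c m * Pᵐ * (Bₙ c n * Pⁿ) - Bₙ c m * Pᵐ * (Aₙ c n * Pⁿ)
        ≡⟨ cong₂ _-_ (cong₂ _*_ (Â-correct m) (B̂-correct n)) (cong₂ _*_ (B̂-correct m) (Â-correct n)) ⟩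
      ℤtoℚ (Â m) * ℤtoℚ (B̂ n) - ℤtoℚ (B̂ m) * ℤtoℚ (Â n)
        ≡⟨ cong₂ _-_ (ℤtoℚ-* (Â m) (B̂ n)) (ℤtoℚ-* (B̂ m) (Â n)) ⟨
      ℤtoℚ (Â m ℤ.* B̂ n) - ℤtoℚ (B̂ m ℤ.* Â n)
        ≡⟨ ℤtoℚ-- (Â m ℤ.* B̂ n) (B̂ m ℤ.* Â n) ⟨
      ℤtoℚ (W m n)
        ∎
      where
      open ≡-Reasoning
      Pᵐ = ℤtoℚ (P ℤ.^ m)
      Pⁿ = ℤtoℚ (P ℤ.^ n)
      distribute : ∀ a b a′ b′ Pᵐ Pⁿ →
                   (a * b′ - b * a′) * (Pᵐ * Pⁿ) ≡ a * Pᵐ * (b′ * Pⁿ) - b * Pᵐ * (a′ * Pⁿ)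
      distribute = solve 6 (λ a b a′ b′ Pᵐ Pⁿ →
        (a :* b′ :- b :* a′) :* (Pᵐ :* Pⁿ) := a :* Pᵐ :* (b′ :* Pⁿ) :- b :* Pᵐ :* (a′ :* Pⁿ)) refl

    product-scaled : ∀ m n → Aₙ c m * Aₙ c n * (ℤtoℚ (P ℤ.^ m) * ℤtoℚ (P ℤ.^ n)) ≡ ℤtoℚ (Â m ℤ.* Â n)
    product-scaled m n = begin
      Aₙ c m * Aₙ c n * (Pᵐ * Pⁿ)  ≡⟨ regroup (Aₙ c m) (Aₙ c n) Pᵐ Pⁿ ⟩
      Aₙ c m * Pᵐ * (Aₙ c n * Pⁿ)  ≡⟨ cong₂ _*_ (Â-correct m) (Â-correct n) ⟩
      ℤtoℚ (Â m) * ℤtoℚ (Â n)      ≡⟨ ℤtoℚ-* (Â m) (Â n) ⟨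
      ℤtoℚ (Â m ℤ.* Â n)           ∎
      where
      open ≡-Reasoning
      Pᵐ = ℤtoℚ (P ℤ.^ m)
      Pⁿ = ℤtoℚ (P ℤ.^ n)
      regroup : ∀ a a′ Pᵐ Pⁿ → a * a′ * (Pᵐ * Pⁿ) ≡ a * Pᵐ * (a′ * Pⁿ)
      regroup = solve 4 (λ a a′ Pᵐ Pⁿ → a :* a′ :* (Pᵐ :* Pⁿ) := a :* Pᵐ :* (a′ :* Pⁿ)) refl

    absLeMul-convergents : ∀ {k} m n → k ≤ m → k ≤ n →
                           AbsLeMul p k (Aₙ c m * Bₙ c n - Bₙ c m * Aₙ c n) (Aₙ c m * Aₙ c n)
    absLeMul-convergents {k} m n k≤m k≤n =
      scaling⇒absLeMul {k} (Aₙ c m * Bₙ c n - Bₙ c m * Aₙ c n) (Aₙ c m * Aₙ c n) _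
        (Pᵐ*Pⁿ≢0 m n) (pᵏ∣W m n k≤m k≤n) (p∤i∧p∤j⇒p∤i*j (p∤Â m) (p∤Â n))
        (det-scaled m n) (product-scaled m n)

    converges : PAdicConverges p c
    converges k = k , λ m n k≤m k≤n → inj₁ (absLeMul-convergents m n k≤m k≤n)

  unit-numerator : ∀ {b} → InO p b → ¬ AbsLeMul p 0 b 1ℚ →
                   ∃ λ s → ∃ λ z → b * ℕtoℚ (p ℕ.^ suc s) ≡ ℤtoℚ z × ¬ + p ∣ℤ z
  unit-numerator {b} (k , a , bpᵏ≡a) ¬b-int = strip k a bpᵏ≡a
    where
    p≢0 : ℕtoℚ p ≢ 0ℚ
    p≢0 p≡0 = ℕ.≢-nonZero⁻¹ p {{prime⇒nonZero p-prime}} (cong ℤ.∣_∣ (ℤtoℚ-injective {+ p} {+ 0} p≡0))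
    strip : ∀ k a → b * ℕtoℚ (p ℕ.^ k) ≡ ℤtoℚ a →
            ∃ λ s → ∃ λ z → b * ℕtoℚ (p ℕ.^ suc s) ≡ ℤtoℚ z × ¬ + p ∣ℤ z
    strip zero a b≡a =
      ⊥-elim (¬b-int (Equivalence.from (absLeMul₀⇔pIntegral {q = b}) (mkPIntegral a 1 p∤1 b≡a)))
    strip (suc k) a bpᵏ⁺¹≡a with + p ∣ℤ? a
    ... | no p∤a = k , a , bpᵏ⁺¹≡a , p∤a
    ... | yes (divides q a≡qp) = strip k q (*-cancelʳ-≡ (ℕtoℚ p) p≢0 (begin
      b * ℕtoℚ (p ℕ.^ k) * ℕtoℚ p    ≡⟨ regroup b (ℕtoℚ (p ℕ.^ k)) (ℕtoℚ p) ⟩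
      b * (ℕtoℚ p * ℕtoℚ (p ℕ.^ k))  ≡⟨ cong (b *_) (ℕtoℚ-* p (p ℕ.^ k)) ⟨
      b * ℕtoℚ (p ℕ.^ suc k)         ≡⟨ bpᵏ⁺¹≡a ⟩
      ℤtoℚ a                         ≡⟨ cong ℤtoℚ a≡qp ⟩
      ℤtoℚ (q ℤ.* + p)               ≡⟨ ℤtoℚ-* q (+ p) ⟩
      ℤtoℚ q * ℕtoℚ p                ∎))
      where
      open ≡-Reasoning
      regroup : ∀ b x y → b * x * y ≡ b * (y * x)
      regroup = solve 3 (λ b x y → b :* x :* y := b :* (y :* x)) refl

  type11-converges : p ≢ 2 → ∀ {b} → InO p b → ¬ AbsLeMul p 0 b 1ℚ → PAdicConverges p (type11 b (b + b))
  type11-converges p≢2 {b} b∈𝒪 ¬b-int = converges (unit-numerator {b} b∈𝒪 ¬b-int)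
    where
    p∤2 : ¬ + p ∣ℤ + 2
    p∤2 p∣2 = [ (λ p≡1 → ¬prime[1] (subst Prime p≡1 p-prime)) , p≢2 ]′ (irreducible[2] (∣⇒∣ᵤ p∣2))
    converges : (∃ λ s → ∃ λ z → b * ℕtoℚ (p ℕ.^ suc s) ≡ ℤtoℚ z × ¬ + p ∣ℤ z) →
                PAdicConverges p (type11 b (b + b))
    converges (s , z , bpˢ⁺¹≡z , p∤z) =
      EqualLargeQuotients.converges (+ (p ℕ.^ suc s)) (∣ᵤ⇒∣ (m∣m*n (p ℕ.^ s)))
                                    (type11 b (b + b)) z′ cP≡z′ p∤z′
      where
      z′ : ℕ → ℤ
      z′ zero = z
      z′ (suc zero) = z
      z′ (suc (suc n)) = z ℤ.+ z
      cP≡z′ : ∀ n → type11 b (b + b) n * ℕtoℚ (p ℕ.^ suc s) ≡ ℤtoℚ (z′ n)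
      cP≡z′ zero = bpˢ⁺¹≡z
      cP≡z′ (suc zero) = bpˢ⁺¹≡z
      cP≡z′ (suc (suc n)) = trans (*-distribʳ-+ (ℕtoℚ (p ℕ.^ suc s)) b b)
                                  (trans (cong₂ _+_ bpˢ⁺¹≡z bpˢ⁺¹≡z) (sym (ℤtoℚ-+ z z)))
      p∤z′ : ∀ n → ¬ + p ∣ℤ z′ n
      p∤z′ zero = p∤z
      p∤z′ (suc zero) = p∤z
      p∤z′ (suc (suc n)) = subst (λ t → ¬ + p ∣ℤ t) (2z≡z+z z) (p∤i∧p∤j⇒p∤i*j p∤2 p∤z)
        where
        2z≡z+z : ∀ z → + 2 ℤ.* z ≡ z ℤ.+ z
        2z≡z+z = ℤ-Solver.solve-∀

module Characterisation {p : ℕ} (p-prime : Prime p) (p≢2 : p ≢ 2) (A C : ℚ) .{{_ : NonZero A}} where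

  Admissible : ℚ → Set
  Admissible b = InO p b × ¬ AbsLeMul p 0 b 1ℚ × ((- C) ÷ A ≡ b * b + 1ℚ)

  inVcon₀⇒admissible : ∀ b a → InVcon p A 0ℚ C b a → a ≡ b + b × Admissible b
  inVcon₀⇒admissible b a (inV , b∈𝒪 , _ , converges) =
    let a≡b+b , -C÷A≡b²+1 = inV₀⇒ A C {b} {a} inV
    in a≡b+b , b∈𝒪 , ¬b-int (subst (λ a → PAdicConverges p (type11 b a)) a≡b+b converges) , -C÷A≡b²+1
    where
    ¬b-int : PAdicConverges p (type11 b (b + b)) → ¬ AbsLeMul p 0 b 1ℚ
    ¬b-int converges b-int = pIntegral⇒¬converges p-prime
      (type11-pIntegral b-int′ (pIntegral-+ p-prime {b} {b} b-int′ b-int′)) converges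
      where
      b-int′ : PIntegral p b
      b-int′ = Equivalence.to absLeMul₀⇔pIntegral b-int

  admissible⇒inVcon₀ : ∀ b → Admissible b → InVcon p A 0ℚ C b (b + b)
  admissible⇒inVcon₀ b (b∈𝒪 , ¬b-int , -C÷A≡b²+1) =
    inV₀-double A C {b} -C÷A≡b²+1 , b∈𝒪 , InO-+ {p} {b} {b} b∈𝒪 b∈𝒪 ,
    type11-converges p-prime p≢2 {b} b∈𝒪 ¬b-int

  admissible-neg : ∀ b → Admissible b → Admissible (- b)
  admissible-neg b (b∈𝒪 , ¬b-int , -C÷A≡b²+1) =
    InO-neg {p} {b} b∈𝒪 , ¬-b-int , trans -C÷A≡b²+1 (square-neg b)
    where
    square-neg : ∀ b → b * b + 1ℚ ≡ - b * - b + 1ℚ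
    square-neg = solve 1 (λ b → b :* b :+ con 1ℚ := :- b :* :- b :+ con 1ℚ) refl
    ¬-b-int : ¬ AbsLeMul p 0 (- b) 1ℚ
    ¬-b-int -b-int = ¬b-int (Equivalence.from absLeMul₀⇔pIntegral (subst (PIntegral p) (neg-involutive b)
                                (pIntegral-neg (Equivalence.to absLeMul₀⇔pIntegral -b-int))))

  admissible-unique : ∀ b b₁ → Admissible b → Admissible b₁ → b ≡ b₁ ⊎ b ≡ - b₁
  admissible-unique b b₁ (_ , _ , -C÷A≡b²+1) (_ , _ , -C÷A≡b₁²+1) =
    p*p≡q*q⇒p≡±q b b₁ (+-cancelʳ 1ℚ (b * b) (b₁ * b₁) (trans (sym -C÷A≡b²+1) -C÷A≡b₁²+1))

  neg-double : ∀ b → - b + - b ≡ - (b + b)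
  neg-double = solve 1 (λ b → :- b :+ :- b := :- (b :+ b)) refl

  inVcon₀⇒± : ∀ b₁ b a → Admissible b₁ → InVcon p A 0ℚ C b a →
              (b ≡ b₁ × a ≡ b₁ + b₁) ⊎ (b ≡ - b₁ × a ≡ - (b₁ + b₁))
  inVcon₀⇒± b₁ b a b₁-adm h =
    let a≡b+b , b-adm = inVcon₀⇒admissible b a h
    in Sum.map (λ b≡b₁ → b≡b₁ , trans a≡b+b (cong (λ t → t + t) b≡b₁))
               (λ b≡-b₁ → b≡-b₁ , trans a≡b+b (trans (cong (λ t → t + t) b≡-b₁) (neg-double b₁)))
               (admissible-unique b b₁ b-adm b₁-adm)

  ±⇒inVcon₀ : ∀ b₁ b a → Admissible b₁ →
              (b ≡ b₁ × a ≡ b₁ + b₁) ⊎ (b ≡ - b₁ × a ≡ - (b₁ + b₁)) → InVcon p A 0ℚ C b a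
  ±⇒inVcon₀ b₁ _ _ b₁-adm (inj₁ (refl , refl)) = admissible⇒inVcon₀ b₁ b₁-adm
  ±⇒inVcon₀ b₁ _ _ b₁-adm (inj₂ (refl , refl)) =
    subst (InVcon p A 0ℚ C (- b₁)) (neg-double b₁) (admissible⇒inVcon₀ (- b₁) (admissible-neg b₁ b₁-adm))

corollary4p6 : (p : ℕ) → Prime p → p ≢ 2 →
    (A C : ℚ) → .{{_ : NonZero A}} →
    ((∃ λ (b₁ : ℚ) → ∃ λ (a₁ : ℚ) → InVcon p A 0ℚ C b₁ a₁) →
       ∃ λ (b₁ : ℚ) → InO p b₁ × ¬ AbsLeMul p 0 b₁ 1ℚ × ((- C) ÷ A ≡ b₁ * b₁ + 1ℚ))
    ×
    ((∃ λ (b₁ : ℚ) → InO p b₁ × ¬ AbsLeMul p 0 b₁ 1ℚ × ((- C) ÷ A ≡ b₁ * b₁ + 1ℚ)) →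
       ∃ λ (b₁ : ℚ) → ∃ λ (a₁ : ℚ) → InVcon p A 0ℚ C b₁ a₁)
    ×
    (∀ (b₁ : ℚ) → InO p b₁ → ¬ AbsLeMul p 0 b₁ 1ℚ → ((- C) ÷ A ≡ b₁ * b₁ + 1ℚ) →
       ∀ (b a : ℚ) →
         (InVcon p A 0ℚ C b a →
            ((b ≡ b₁) × (a ≡ b₁ + b₁)) ⊎ ((b ≡ - b₁) × (a ≡ - (b₁ + b₁))))
         ×
         ((((b ≡ b₁) × (a ≡ b₁ + b₁)) ⊎ ((b ≡ - b₁) × (a ≡ - (b₁ + b₁)))) →
            InVcon p A 0ℚ C b a))
corollary4p6 p p-prime p≢2 A C =
  (λ (b , a , h) → b , proj₂ (inVcon₀⇒admissible b a h)) ,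
  (λ (b , b-adm) → b , b + b , admissible⇒inVcon₀ b b-adm) ,
  λ b₁ b₁∈𝒪 ¬b₁-int -C÷A≡b₁²+1 b a →
    let b₁-adm = b₁∈𝒪 , ¬b₁-int , -C÷A≡b₁²+1
    in inVcon₀⇒± b₁ b a b₁-adm , ±⇒inVcon₀ b₁ b a b₁-adm
  where open Characterisation p-prime p≢2 A C
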